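{- Let $n\geq 1$. Let $b(n)$ be the total number of parts in all partitions of $n$ into odd parts minus the total number of parts in all partitions of $n$ into distinct parts. For a partition $\mu$ with parts $\mu_j=2^{k_j}m_j$, where $m_j$ is odd and $k_j\ge 0$, define its weight $wt(\mu)=\sum_{j=1}^{\ell(\mu)}(2^{k_j}-1)$, with $\ell(\mu)$ the number of parts of $\mu$. Let $\mathcal{MD}(n)$ be the multiset of partitions of $n$ into distinct parts in which each such partition $\mu$ appears exactly $wt(\mu)$ times. Then $b(n)=|\mathcal{MD}(n)|=\sum_{\mu} wt(\mu)$, where the sum runs over all partitions $\mu$ of $n$ into distinct parts.
   Context: A partition of $n$ is a non-increasing sequence of positive integers (its parts) summing to $n$; parts are counted with multiplicity. -}

module Defs where

open import Data.Nat using (ℕ; zero; suc; _+_; _*_; _∸_; _^_; _≤_; _<_; _≤ᵇ_; _<ᵇ_)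
open import Data.Nat.DivMod using (_%_; _/_)
open import Data.Bool using (Bool; true; false; _∧_; not)
open import Data.List using (List; []; _∷_; length; map; filter; concatMap; upTo)
open import Data.Nat.ListAction using (sum)
open import Data.List.Relation.Unary.All using (All)
open import Data.Integer as ℤ using (ℤ)
open import Relation.Binary.PropositionalEquality using (_≡_)

-- A partition is represented as a list of its parts in non-increasing order.

-- Defined by recursion on a fuel
-- parameter (the fuel n suffices since every part is ≥ 1).
partsAux : ℕ → ℕ → ℕ → List (List ℕ)
partsAux fuel zero m = [] ∷ []
partsAux zero (suc n) m = []
partsAux (suc fuel) (suc n) m =
  concatMap (λ k → map (λ rest → suc k ∷ rest) (partsAux fuel (suc n ∸ suc k) (suc k)))
            (filter (λ k → suc k Data.Nat.≤? m) (upTo (suc n)))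

partitions : ℕ → List (List ℕ)
partitions n = partsAux n n n

isOdd : ℕ → Bool
isOdd k = (k % 2) Data.Nat.≡ᵇ 1

allOddParts : List ℕ → Bool
allOddParts [] = true
allOddParts (x ∷ xs) = isOdd x ∧ allOddParts xs

-- parts are distinct (for a non-increasing list: strictly decreasing)
distinctParts : List ℕ → Bool
distinctParts [] = true
distinctParts (x ∷ []) = true
distinctParts (x ∷ y ∷ xs) = (y <ᵇ x) ∧ distinctParts (y ∷ xs)

oddPartitions : ℕ → List (List ℕ)
oddPartitions n = filter (λ μ → Data.Bool.T? (allOddParts μ)) (partitions n)

distinctPartitions : ℕ → List (List ℕ)
distinctPartitions n = filter (λ μ → Data.Bool.T? (distinctParts μ)) (partitions n)

totalParts : List (List ℕ) → ℕ
totalParts ps = sum (map length ps)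

b : ℕ → ℤ
b n = ℤ.+ totalParts (oddPartitions n) ℤ.- ℤ.+ totalParts (distinctPartitions n)

-- 2-adic power: for k ≥ 1 write k = 2^e * m with m odd; twoPow k = 2^e.
-- (fuel-based; fuel k suffices.)
twoPowAux : ℕ → ℕ → ℕ
twoPowAux zero k = 1
twoPowAux (suc fuel) zero = 1
twoPowAux (suc fuel) (suc k) with isOdd (suc k)
... | true  = 1
... | false = 2 * twoPowAux fuel ((suc k) / 2)

twoPow : ℕ → ℕ
twoPow k = twoPowAux k k

wt : List ℕ → ℕ
wt μ = sum (map (λ p → twoPow p ∸ 1) μ)

replicateL : {A : Set} → ℕ → A → List A
replicateL zero a = []
replicateL (suc k) a = a ∷ replicateL k a

MD : ℕ → List (List ℕ)
MD n = concatMap (λ μ → replicateL (wt μ) μ) (distinctPartitions n)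

{-# OPTIONS --safe #-}

-- Both totals are derivatives at t = 1 of generating functions:
--   Σ_{λ odd}      t^ℓ(λ) q^|λ|        = ∏_{m odd} 1 / (1 − t qᵐ),
--   Σ_{μ distinct} t^(Σⱼ 2^kⱼ) q^|μ|  = ∏_{k ≥ 1} (1 + t^(2^ν(k)) qᵏ),   2^ν(k) the 2-part of k.
-- The products agree: Glaisher's identity 1 / (1 − a qᴹ) = (1 + a qᴹ) / (1 − a² q²ᴹ),
-- applied to the factor of each odd m until its exponent 2ᵉ m exceeds n, produces
-- exactly the factors 1 + t^(2ᵉ) q^(2ᵉ m) of the second product.  Differentiating, the
-- parts of the odd partitions of n number Σ_μ Σⱼ 2^kⱼ = Σ_μ (ℓ(μ) + wt(μ)), whence
-- b(n) = Σ_μ wt(μ).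
-- The derivative is taken by computing with dual numbers t = 1 + ε, and power series
-- are handled through linear operators on coefficient sequences, 1 / (1 − a qᴹ) being
-- the unique solution g of g = f + a qᴹ g.

module Submission where

open import Data.Bool using (Bool; true; false; if_then_else_; T?)
open import Data.Empty using (⊥-elim)
open import Data.Integer as ℤ using (+_)
import Data.Integer.Properties as ℤ
open import Data.List using (List; []; _∷_; _++_; map; filter; concatMap; applyUpTo; upTo; length)
open import Data.List.Properties using (concatMap-cong; length-++)
open import Data.Nat
open import Data.Nat.DivMod using (_/_; m*n%n≡0; [m+kn]%n≡m%n; m*n/n≡m)
open import Data.Nat.Induction using (<-rec)
open import Data.Nat.ListAction using (sum)
open import Data.Nat.Properties
open import Algebra.Properties.CommutativeSemigroup +-commutativeSemigroup
  using () renaming (interchange to +-interchange)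
open import Data.Nat.Tactic.RingSolver using (solve-∀)
open import Data.Product using (∃; ∃₂; _×_; _,_; proj₂)
open import Data.Sum using (_⊎_; inj₁; inj₂)
open import Function using (_∘_; id)
open import Relation.Binary.Definitions using (tri<; tri≈; tri>)
open import Relation.Binary.PropositionalEquality
open import Relation.Nullary using (Dec; does; yes; no)
open import Relation.Unary using (Decidable)

open import Defs

-- (a , b) stands for a + bε with ε² = 0.  Substituting t = 1 + ε turns a
-- polynomial in t into (its value at 1 , its derivative at 1); in particular
-- tᵏ becomes t^ k = (1 , k).
Dual : Set
Dual = ℕ × ℕ

infixl 6 _⊕_
infixl 7 _⋆_
infix 8 t^_

_⊕_ : Dual → Dual → Dual
(a , b) ⊕ (c , d) = (a + c , b + d)

_⋆_ : Dual → Dual → Dual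
(a , b) ⋆ (c , d) = (a * c , a * d + b * c)

0ᴰ : Dual
0ᴰ = (0 , 0)

t^_ : ℕ → Dual
t^ k = (1 , k)

⊕-assoc : ∀ x y z → x ⊕ y ⊕ z ≡ x ⊕ (y ⊕ z)
⊕-assoc (a , b) (c , d) (e , f) = cong₂ _,_ (+-assoc a c e) (+-assoc b d f)

⊕-comm : ∀ x y → x ⊕ y ≡ y ⊕ x
⊕-comm (a , b) (c , d) = cong₂ _,_ (+-comm a c) (+-comm b d)

⊕-identityʳ : ∀ x → x ⊕ 0ᴰ ≡ x
⊕-identityʳ (a , b) = cong₂ _,_ (+-identityʳ a) (+-identityʳ b)

⊕-interchange : ∀ x y z w → (x ⊕ y) ⊕ (z ⊕ w) ≡ (x ⊕ z) ⊕ (y ⊕ w)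
⊕-interchange (a , b) (c , d) (e , f) (g , h) =
  cong₂ _,_ (+-interchange a c e g) (+-interchange b d f h)

⋆-comm : ∀ x y → x ⋆ y ≡ y ⋆ x
⋆-comm (a , b) (c , d) = cong₂ _,_ (*-comm a c) (lemma a b c d)
  where
  lemma : ∀ a b c d → a * d + b * c ≡ c * b + d * a
  lemma = solve-∀

⋆-assoc : ∀ x y z → x ⋆ y ⋆ z ≡ x ⋆ (y ⋆ z)
⋆-assoc (a , b) (c , d) (e , f) = cong₂ _,_ (*-assoc a c e) (lemma a b c d e f)
  where
  lemma : ∀ a b c d e f → a * c * f + (a * d + b * c) * e ≡ a * (c * f + d * e) + b * (c * e)
  lemma = solve-∀

⋆-distribˡ-⊕ : ∀ x y z → x ⋆ (y ⊕ z) ≡ x ⋆ y ⊕ x ⋆ z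
⋆-distribˡ-⊕ (a , b) (c , d) (e , f) = cong₂ _,_ (*-distribˡ-+ a c e) (lemma a b c d e f)
  where
  lemma : ∀ a b c d e f → a * (d + f) + b * (c + e) ≡ a * d + b * c + (a * f + b * e)
  lemma = solve-∀

⋆-zeroʳ : ∀ x → x ⋆ 0ᴰ ≡ 0ᴰ
⋆-zeroʳ (a , b) = cong₂ _,_ (*-zeroʳ a) (cong₂ _+_ (*-zeroʳ a) (*-zeroʳ b))

⋆-zeroˡ : ∀ x → 0ᴰ ⋆ x ≡ 0ᴰ
⋆-zeroˡ x = trans (⋆-comm 0ᴰ x) (⋆-zeroʳ x)

x⋆yz≡y⋆xz : ∀ x y z → x ⋆ (y ⋆ z) ≡ y ⋆ (x ⋆ z)
x⋆yz≡y⋆xz x y z = trans (sym (⋆-assoc x y z)) (trans (cong (_⋆ z) (⋆-comm x y)) (⋆-assoc y x z))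

t^-+ : ∀ j k → t^ j ⋆ t^ k ≡ t^ (j + k)
t^-+ j k = cong (1 ,_) (lemma j k)
  where
  lemma : ∀ j k → 1 * k + j * 1 ≡ j + k
  lemma = solve-∀

-- Power series in q, as coefficient sequences

Series : Set
Series = ℕ → Dual

infixl 6 _⊞_
infixr 7 _⊙_
infix 4 _≗[_]_

_⊞_ : Series → Series → Series
(f ⊞ g) n = f n ⊕ g n

_⊙_ : Dual → Series → Series
(a ⊙ f) n = a ⋆ f n

δ : Series
δ zero = t^ 0
δ (suc n) = 0ᴰ

shift₁ : Series → Series
shift₁ f zero = 0ᴰ
shift₁ f (suc n) = f n

shift : ℕ → Series → Series
shift zero f = f
shift (suc M) f = shift₁ (shift M f)

-- equality modulo q^(B+1)
_≗[_]_ : Series → ℕ → Series → Set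
f ≗[ B ] g = ∀ j → j ≤ B → f j ≡ g j

shift₁-cong : ∀ {f g} → f ≗ g → shift₁ f ≗ shift₁ g
shift₁-cong f≗g zero = refl
shift₁-cong f≗g (suc n) = f≗g n

shift-agree : ∀ M {f g i} → f ≗[ i ] g → shift M f i ≡ shift M g i
shift-agree zero {i = i} f≗g = f≗g i ≤-refl
shift-agree (suc M) {i = zero} f≗g = refl
shift-agree (suc M) {i = suc i} f≗g = shift-agree M (λ j j≤i → f≗g j (m≤n⇒m≤1+n j≤i))

shift-suc-agree : ∀ M {f g i} → (∀ j → j < i → f j ≡ g j) → shift (suc M) f i ≡ shift (suc M) g i
shift-suc-agree M {i = zero} f≗g = refl
shift-suc-agree M {i = suc i} f≗g = shift-agree M (λ j j≤i → f≗g j (s≤s j≤i))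

shift-cong : ∀ M {f g} → f ≗ g → shift M f ≗ shift M g
shift-cong M f≗g i = shift-agree M (λ j _ → f≗g j)

shift-⊞ : ∀ M f g → shift M (f ⊞ g) ≗ shift M f ⊞ shift M g
shift-⊞ zero f g n = refl
shift-⊞ (suc M) f g zero = refl
shift-⊞ (suc M) f g (suc n) = shift-⊞ M f g n

shift-⊙ : ∀ M a f → shift M (a ⊙ f) ≗ a ⊙ shift M f
shift-⊙ zero a f n = refl
shift-⊙ (suc M) a f zero = sym (⋆-zeroʳ a)
shift-⊙ (suc M) a f (suc n) = shift-⊙ M a f n

shift-shift₁ : ∀ M f → shift M (shift₁ f) ≗ shift₁ (shift M f)
shift-shift₁ zero f n = refl
shift-shift₁ (suc M) f = shift₁-cong (shift-shift₁ M f)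

shift-+ : ∀ M K f → shift M (shift K f) ≗ shift (M + K) f
shift-+ zero K f n = refl
shift-+ (suc M) K f = shift₁-cong (shift-+ M K f)

shift-below : ∀ M f {i} → i < M → shift M f i ≡ 0ᴰ
shift-below (suc M) f {zero} i<M = refl
shift-below (suc M) f {suc i} (s≤s i<M) = shift-below M f i<M

shift-above : ∀ M f {n} → M ≤ n → shift M f n ≡ f (n ∸ M)
shift-above zero f _ = refl
shift-above (suc M) f {suc n} (s≤s M≤n) = shift-above M f M≤n

affine : Dual → ℕ → Series → Series → Series
affine a M f h = f ⊞ a ⊙ shift M h

affine-cong : ∀ a M {f f′ h h′} → f ≗ f′ → h ≗ h′ → affine a M f h ≗ affine a M f′ h′
affine-cong a M f≗f′ h≗h′ n = cong₂ (λ u v → u ⊕ a ⋆ v) (f≗f′ n) (shift-cong M h≗h′ n)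

affine-⊞ : ∀ a M f h f′ h′ →
           affine a M f h ⊞ affine a M f′ h′ ≗ affine a M (f ⊞ f′) (h ⊞ h′)
affine-⊞ a M f h f′ h′ n = begin
  (f n ⊕ a ⋆ shift M h n) ⊕ (f′ n ⊕ a ⋆ shift M h′ n)
    ≡⟨ ⊕-interchange (f n) _ (f′ n) _ ⟩
  (f n ⊕ f′ n) ⊕ (a ⋆ shift M h n ⊕ a ⋆ shift M h′ n)
    ≡⟨ cong ((f n ⊕ f′ n) ⊕_) (⋆-distribˡ-⊕ a _ _) ⟨
  (f n ⊕ f′ n) ⊕ a ⋆ (shift M h n ⊕ shift M h′ n)
    ≡⟨ cong (λ z → (f n ⊕ f′ n) ⊕ a ⋆ z) (shift-⊞ M h h′ n) ⟨
  (f n ⊕ f′ n) ⊕ a ⋆ shift M (h ⊞ h′) n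
    ∎
  where open ≡-Reasoning

affine-⊙ : ∀ a M c f h → c ⊙ affine a M f h ≗ affine a M (c ⊙ f) (c ⊙ h)
affine-⊙ a M c f h n = begin
  c ⋆ (f n ⊕ a ⋆ shift M h n)      ≡⟨ ⋆-distribˡ-⊕ c _ _ ⟩
  c ⋆ f n ⊕ c ⋆ (a ⋆ shift M h n)  ≡⟨ cong (c ⋆ f n ⊕_) (x⋆yz≡y⋆xz c a _) ⟩
  c ⋆ f n ⊕ a ⋆ (c ⋆ shift M h n)  ≡⟨ cong (λ z → c ⋆ f n ⊕ a ⋆ z) (shift-⊙ M c h n) ⟨
  c ⋆ f n ⊕ a ⋆ shift M (c ⊙ h) n  ∎
  where open ≡-Reasoning

affine-shift₁ : ∀ a M f h → shift₁ (affine a M f h) ≗ affine a M (shift₁ f) (shift₁ h)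
affine-shift₁ a M f h zero = begin
  0ᴰ                                ≡⟨ ⊕-identityʳ 0ᴰ ⟨
  0ᴰ ⊕ 0ᴰ                           ≡⟨ cong (0ᴰ ⊕_) (⋆-zeroʳ a) ⟨
  0ᴰ ⊕ a ⋆ 0ᴰ                       ≡⟨ cong (λ z → 0ᴰ ⊕ a ⋆ z) (shift-shift₁ M h zero) ⟨
  0ᴰ ⊕ a ⋆ shift M (shift₁ h) zero  ∎
  where open ≡-Reasoning
affine-shift₁ a M f h (suc n) = cong (λ z → f n ⊕ a ⋆ z) (sym (shift-shift₁ M h (suc n)))

-- geometric a M f is f / (1 − a qᴹ), i.e. the solution g of g = f + a qᴹ g;
-- for M ≥ 1, n + 1 rounds of this iteration already fix the coefficient of qⁿ.
geometricIter : Dual → ℕ → ℕ → Series → Series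
geometricIter a M zero f n = f n
geometricIter a M (suc rounds) f n = f n ⊕ a ⋆ shift M (geometricIter a M rounds f) n

geometric : Dual → ℕ → Series → Series
geometric a M f n = geometricIter a M (suc n) f n

SolvesGeometric : Dual → ℕ → Series → Series → Set
SolvesGeometric a M f g = g ≗ affine a M f g

geometricIter-stable : ∀ a M f {r r′ i} → i < r → i < r′ →
                       geometricIter a (suc M) r f i ≡ geometricIter a (suc M) r′ f i
geometricIter-stable a M f {suc r} {suc r′} {i} (s≤s i≤r) (s≤s i≤r′) =
  cong (λ z → f i ⊕ a ⋆ z) (shift-suc-agree M (λ j j<i →
    geometricIter-stable a M f (≤-trans j<i i≤r) (≤-trans j<i i≤r′)))

geometric-solves : ∀ a M f → SolvesGeometric a (suc M) f (geometric a (suc M) f)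
geometric-solves a M f n = cong (λ z → f n ⊕ a ⋆ z) (shift-suc-agree M (λ j j<n →
  geometricIter-stable a M f {n} {suc j} j<n ≤-refl))

solutions-agree : ∀ {a M f f′ g g′ B} →
                  SolvesGeometric a (suc M) f g → SolvesGeometric a (suc M) f′ g′ →
                  f ≗[ B ] f′ → g ≗[ B ] g′
solutions-agree {a} {M} {f} {f′} {g} {g′} {B} g-solves g′-solves f≗f′ =
  <-rec (λ n → n ≤ B → g n ≡ g′ n) step
  where
  step : ∀ n → (∀ {j} → j < n → j ≤ B → g j ≡ g′ j) → n ≤ B → g n ≡ g′ n
  step n below n≤B = begin
    g n
      ≡⟨ g-solves n ⟩
    f n ⊕ a ⋆ shift (suc M) g n
      ≡⟨ cong₂ (λ u v → u ⊕ a ⋆ v) (f≗f′ n n≤B)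
               (shift-suc-agree M (λ j j<n → below j<n (≤-trans (<⇒≤ j<n) n≤B))) ⟩
    f′ n ⊕ a ⋆ shift (suc M) g′ n
      ≡⟨ g′-solves n ⟨
    g′ n
      ∎
    where open ≡-Reasoning

geometric-unique : ∀ a M f {g} → SolvesGeometric a (suc M) f g → g ≗ geometric a (suc M) f
geometric-unique a M f g-solves n =
  solutions-agree {a} {M} {f} {f} g-solves (geometric-solves a M f) (λ _ _ → refl) n ≤-refl

geometric-below : ∀ a M f {j} → j < M → geometric a M f j ≡ f j
geometric-below a (suc M) f {j} j<M = begin
  geometric a (suc M) f j
    ≡⟨ geometric-solves a M f j ⟩
  f j ⊕ a ⋆ shift (suc M) (geometric a (suc M) f) j
    ≡⟨ cong (λ z → f j ⊕ a ⋆ z) (shift-below (suc M) _ j<M) ⟩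
  f j ⊕ a ⋆ 0ᴰ
    ≡⟨ cong (f j ⊕_) (⋆-zeroʳ a) ⟩
  f j ⊕ 0ᴰ
    ≡⟨ ⊕-identityʳ (f j) ⟩
  f j
    ∎
  where open ≡-Reasoning

record ShiftLinear (O : Series → Series) : Set where
  field
    cong-≗    : ∀ {f g} → f ≗ g → O f ≗ O g
    ⊞-hom     : ∀ f g → O (f ⊞ g) ≗ O f ⊞ O g
    ⊙-hom     : ∀ a f → O (a ⊙ f) ≗ a ⊙ O f
    shift₁-hom : ∀ f → O (shift₁ f) ≗ shift₁ (O f)

  shift-hom : ∀ M f → O (shift M f) ≗ shift M (O f)
  shift-hom zero f n = refl
  shift-hom (suc M) f n = trans (shift₁-hom (shift M f) n) (shift₁-cong (shift-hom M f) n)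

  affine-hom : ∀ a M f h → O (affine a M f h) ≗ affine a M (O f) (O h)
  affine-hom a M f h n = begin
    O (f ⊞ a ⊙ shift M h) n          ≡⟨ ⊞-hom f _ n ⟩
    O f n ⊕ O (a ⊙ shift M h) n      ≡⟨ cong (O f n ⊕_) (⊙-hom a _ n) ⟩
    O f n ⊕ a ⋆ O (shift M h) n      ≡⟨ cong (λ z → O f n ⊕ a ⋆ z) (shift-hom M h n) ⟩
    O f n ⊕ a ⋆ shift M (O h) n      ∎
    where open ≡-Reasoning

open ShiftLinear

id-linear : ShiftLinear id
id-linear = record
  { cong-≗ = id
  ; ⊞-hom = λ _ _ _ → refl
  ; ⊙-hom = λ _ _ _ → refl
  ; shift₁-hom = λ _ _ → refl
  }

∘-linear : ∀ {O P} → ShiftLinear O → ShiftLinear P → ShiftLinear (O ∘ P)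
∘-linear {O} {P} O-lin P-lin = record
  { cong-≗ = cong-≗ O-lin ∘ cong-≗ P-lin
  ; ⊞-hom = λ f g n → trans (cong-≗ O-lin (⊞-hom P-lin f g) n) (⊞-hom O-lin (P f) (P g) n)
  ; ⊙-hom = λ a f n → trans (cong-≗ O-lin (⊙-hom P-lin a f) n) (⊙-hom O-lin a (P f) n)
  ; shift₁-hom = λ f n → trans (cong-≗ O-lin (shift₁-hom P-lin f) n) (shift₁-hom O-lin (P f) n)
  }

-- multiplication by 1 + a qᴹ
binomial : Dual → ℕ → Series → Series
binomial a M f = affine a M f f

binomial-linear : ∀ a M → ShiftLinear (binomial a M)
binomial-linear a M = record
  { cong-≗ = λ f≗g → affine-cong a M f≗g f≗g
  ; ⊞-hom = λ f g n → sym (affine-⊞ a M f f g g n)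
  ; ⊙-hom = λ c f n → sym (affine-⊙ a M c f f n)
  ; shift₁-hom = λ f n → sym (affine-shift₁ a M f f n)
  }

geometric-linear : ∀ a M → ShiftLinear (geometric a (suc M))
geometric-linear a M = record
  { cong-≗ = λ {f} {g} f≗g → geometric-unique a M g (λ n →
      trans (geometric-solves a M f n) (affine-cong a (suc M) f≗g (λ _ → refl) n))
  ; ⊞-hom = λ f g n → sym (geometric-unique a M (f ⊞ g) (λ n →
      trans (cong₂ _⊕_ (geometric-solves a M f n) (geometric-solves a M g n))
            (affine-⊞ a (suc M) f (G f) g (G g) n)) n)
  ; ⊙-hom = λ c f n → sym (geometric-unique a M (c ⊙ f) (λ n →
      trans (cong (c ⋆_) (geometric-solves a M f n)) (affine-⊙ a (suc M) c f (G f) n)) n)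
  ; shift₁-hom = λ f n → sym (geometric-unique a M (shift₁ f) (λ n →
      trans (shift₁-cong (geometric-solves a M f) n) (affine-shift₁ a (suc M) f (G f) n)) n)
  }
  where
  G : Series → Series
  G = geometric a (suc M)

binomial-comm : ∀ {O} → ShiftLinear O → ∀ a M f → O (binomial a M f) ≗ binomial a M (O f)
binomial-comm O-lin a M f = affine-hom O-lin a M f f

binomial-agree : ∀ a M {f g B} → f ≗[ B ] g → binomial a M f ≗[ B ] binomial a M g
binomial-agree a M f≗g j j≤B =
  cong₂ (λ u v → u ⊕ a ⋆ v) (f≗g j j≤B) (shift-agree M (λ k k≤j → f≗g k (≤-trans k≤j j≤B)))

geometric-split : ∀ a M f → geometric a (suc M) f ≗ binomial a (suc M) (geometric (a ⋆ a) (suc M + suc M) f)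
geometric-split a M f n = sym (geometric-unique a M f solves n)
  where
  h X : Series
  h = geometric (a ⋆ a) (suc M + suc M) f
  X = shift (suc M) h
  solves : SolvesGeometric a (suc M) f (binomial a (suc M) h)
  solves n = begin
    h n ⊕ a ⋆ X n
      ≡⟨ cong (_⊕ a ⋆ X n) (geometric-solves (a ⋆ a) (M + suc M) f n) ⟩
    (f n ⊕ (a ⋆ a) ⋆ shift (suc M + suc M) h n) ⊕ a ⋆ X n
      ≡⟨ cong (λ z → (f n ⊕ (a ⋆ a) ⋆ z) ⊕ a ⋆ X n) (shift-+ (suc M) (suc M) h n) ⟨
    (f n ⊕ (a ⋆ a) ⋆ shift (suc M) X n) ⊕ a ⋆ X n
      ≡⟨ ⊕-assoc (f n) _ _ ⟩
    f n ⊕ ((a ⋆ a) ⋆ shift (suc M) X n ⊕ a ⋆ X n)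
      ≡⟨ cong (f n ⊕_) (⊕-comm _ (a ⋆ X n)) ⟩
    f n ⊕ (a ⋆ X n ⊕ (a ⋆ a) ⋆ shift (suc M) X n)
      ≡⟨ cong (λ z → f n ⊕ (a ⋆ X n ⊕ z)) (⋆-assoc a a _) ⟩
    f n ⊕ (a ⋆ X n ⊕ a ⋆ (a ⋆ shift (suc M) X n))
      ≡⟨ cong (f n ⊕_) (⋆-distribˡ-⊕ a _ _) ⟨
    f n ⊕ a ⋆ (X n ⊕ a ⋆ shift (suc M) X n)
      ≡⟨ cong (λ z → f n ⊕ a ⋆ (X n ⊕ z)) (shift-⊙ (suc M) a X n) ⟨
    f n ⊕ a ⋆ (X n ⊕ shift (suc M) (a ⊙ X) n)
      ≡⟨ cong (λ z → f n ⊕ a ⋆ z) (shift-⊞ (suc M) h (a ⊙ X) n) ⟨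
    f n ⊕ a ⋆ shift (suc M) (binomial a (suc M) h) n
      ∎
    where open ≡-Reasoning

isOdd-2* : ∀ q → isOdd (2 * q) ≡ false
isOdd-2* q = trans (cong isOdd (*-comm 2 q)) (cong (_≡ᵇ 1) (m*n%n≡0 q 2))

odd⇒pos : ∀ {m} → isOdd m ≡ true → 1 ≤ m
odd⇒pos {suc m} _ = s≤s z≤n

evenOrOdd : ∀ n → (∃ λ q → n ≡ q * 2) ⊎ (∃ λ q → n ≡ 1 + q * 2)
evenOrOdd zero = inj₁ (0 , refl)
evenOrOdd (suc n) with evenOrOdd n
... | inj₁ (q , n≡2q)   = inj₂ (q , cong suc n≡2q)
... | inj₂ (q , n≡2q+1) = inj₁ (suc q , cong suc n≡2q+1)

twoAdic : ∀ n → ∃₂ λ k m → isOdd m ≡ true × 2 ^ k * m ≡ suc n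
twoAdic = <-rec _ λ n rec → split n rec (evenOrOdd (suc n))
  where
  split : ∀ n → (∀ {j} → j < n → ∃₂ λ k m → isOdd m ≡ true × 2 ^ k * m ≡ suc j) →
          (∃ λ q → suc n ≡ q * 2) ⊎ (∃ λ q → suc n ≡ 1 + q * 2) →
          ∃₂ λ k m → isOdd m ≡ true × 2 ^ k * m ≡ suc n
  split n rec (inj₂ (q , n≡2q+1)) =
    0 , suc n , trans (cong isOdd n≡2q+1) (cong (_≡ᵇ 1) ([m+kn]%n≡m%n 1 q 2)) , *-identityˡ (suc n)
  split n rec (inj₁ (suc q , n≡2q)) with rec {q} q<n
    where
    q<n : q < n
    q<n = subst (q <_) (suc-injective (sym n≡2q)) (s≤s (m≤m*n q 2))
  ... | k , m , m-odd , 2ᵏm≡1+q =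
    suc k , m , m-odd ,
    trans (*-assoc 2 (2 ^ k) m) (trans (cong (2 *_) 2ᵏm≡1+q) (trans (*-comm 2 (suc q)) (sym n≡2q)))

odd-part-unique : ∀ k k′ {m m′} → isOdd m ≡ true → isOdd m′ ≡ true →
                  2 ^ k * m ≡ 2 ^ k′ * m′ → m ≡ m′
odd-part-unique zero zero {m} {m′} _ _ eq = trans (sym (*-identityˡ m)) (trans eq (*-identityˡ m′))
odd-part-unique zero (suc k′) {m} {m′} m-odd _ eq with () ← trans (sym m-odd)
  (trans (cong isOdd (trans (sym (*-identityˡ m)) (trans eq (*-assoc 2 (2 ^ k′) m′))))
         (isOdd-2* (2 ^ k′ * m′)))
odd-part-unique (suc k) zero m-odd m′-odd eq = sym (odd-part-unique zero (suc k) m′-odd m-odd (sym eq))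
odd-part-unique (suc k) (suc k′) {m} {m′} m-odd m′-odd eq = odd-part-unique k k′ m-odd m′-odd
  (*-cancelˡ-≡ _ _ 2 (trans (sym (*-assoc 2 (2 ^ k) m)) (trans eq (*-assoc 2 (2 ^ k′) m′))))

twoPowAux-pos : ∀ fuel k → 1 ≤ twoPowAux fuel k
twoPowAux-pos zero k = ≤-refl
twoPowAux-pos (suc fuel) zero = ≤-refl
twoPowAux-pos (suc fuel) (suc k) with isOdd (suc k)
... | true = ≤-refl
... | false = ≤-trans (twoPowAux-pos fuel (suc k / 2)) (m≤n*m _ 2)

twoPow-pos : ∀ k → 1 ≤ twoPow k
twoPow-pos k = twoPowAux-pos k k

twoPowAux-double : ∀ fuel y → 1 ≤ y → twoPowAux (suc fuel) (2 * y) ≡ 2 * twoPowAux fuel y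
twoPowAux-double fuel (suc y) _ rewrite isOdd-2* (suc y) =
  cong (λ z → 2 * twoPowAux fuel z) (trans (cong (_/ 2) (*-comm 2 (suc y))) (m*n/n≡m (suc y) 2))

twoPowAux-odd : ∀ fuel m → isOdd (suc m) ≡ true → twoPowAux (suc fuel) (suc m) ≡ 1
twoPowAux-odd fuel m m-odd rewrite m-odd = refl

2ᵏm-pos : ∀ k {m} → isOdd m ≡ true → 1 ≤ 2 ^ k * m
2ᵏm-pos k m-odd = *-mono-≤ (m^n>0 2 k) (odd⇒pos m-odd)

twoPowAux-odd-part : ∀ k {m} fuel → isOdd m ≡ true → 2 ^ k * m ≤ fuel →
                     twoPowAux fuel (2 ^ k * m) ≡ 2 ^ k
twoPowAux-odd-part zero {suc m} (suc fuel) m-odd _ =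
  trans (cong (twoPowAux (suc fuel)) (*-identityˡ (suc m))) (twoPowAux-odd fuel m m-odd)
twoPowAux-odd-part (suc k) zero m-odd bound with () ← ≤-trans (2ᵏm-pos (suc k) m-odd) bound
twoPowAux-odd-part (suc k) {m} (suc fuel) m-odd bound = begin
  twoPowAux (suc fuel) (2 ^ suc k * m)  ≡⟨ cong (twoPowAux (suc fuel)) (*-assoc 2 (2 ^ k) m) ⟩
  twoPowAux (suc fuel) (2 * y)          ≡⟨ twoPowAux-double fuel y y-pos ⟩
  2 * twoPowAux fuel y                  ≡⟨ cong (2 *_) (twoPowAux-odd-part k fuel m-odd y≤fuel) ⟩
  2 * 2 ^ k                             ∎
  where
  open ≡-Reasoning
  y : ℕ
  y = 2 ^ k * m
  y-pos : 1 ≤ y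
  y-pos = 2ᵏm-pos k m-odd
  y≤fuel : y ≤ fuel
  y≤fuel = ≤-pred (≤-trans (m<m+n y (≤-trans y-pos (m≤m+n y 0)))
                           (subst (_≤ suc fuel) (*-assoc 2 (2 ^ k) m) bound))

twoPow-odd-part : ∀ k {m} → isOdd m ≡ true → twoPow (2 ^ k * m) ≡ 2 ^ k
twoPow-odd-part k m-odd = twoPowAux-odd-part k _ m-odd ≤-refl

-- Glaisher's rearrangement of the odd product

-- For x ≥ 1, exponent N x is the least e with N < 2ᵉ x.
exponent : ℕ → ℕ → ℕ
exponent zero x = 0
exponent (suc N) x with 2 ^ exponent N x * x ≟ suc N
... | yes _ = suc (exponent N x)
... | no _  = exponent N x

exponent-bound : ∀ N {x} → 1 ≤ x → N < 2 ^ exponent N x * x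
exponent-bound zero {x} 1≤x = subst (1 ≤_) (sym (*-identityˡ x)) 1≤x
exponent-bound (suc N) {x} 1≤x with 2 ^ exponent N x * x ≟ suc N
... | yes 2ᵉx≡1+N = subst (suc N <_) (sym (trans (*-assoc 2 (2 ^ exponent N x) x) (cong (2 *_) 2ᵉx≡1+N)))
                          (m<m+n (suc N) (s≤s z≤n))
... | no 2ᵉx≢1+N = ≤∧≢⇒< (exponent-bound N 1≤x) (2ᵉx≢1+N ∘ sym)

exponent-minimal : ∀ N {x e} → e < exponent N x → 2 ^ e * x ≤ N
exponent-minimal (suc N) {x} {e} e<exp with 2 ^ exponent N x * x ≟ suc N
... | yes 2ᵉx≡1+N = ≤-trans (*-monoˡ-≤ x (^-monoʳ-≤ 2 (≤-pred e<exp))) (≤-reflexive 2ᵉx≡1+N)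
... | no _ = m≤n⇒m≤1+n (exponent-minimal N e<exp)

exponent-exact : ∀ {N k x} → 1 ≤ x → 2 ^ k * x ≡ suc N → exponent N x ≡ k
exponent-exact {N} {k} {x} 1≤x 2ᵏx≡1+N with <-cmp (exponent N x) k
... | tri≈ _ e≡k _ = e≡k
... | tri< e<k _ _ = ⊥-elim (<-irrefl refl (begin-strict
  suc N                     ≤⟨ exponent-bound N 1≤x ⟩
  2 ^ exponent N x * x      <⟨ *-monoˡ-< x {{>-nonZero 1≤x}} (^-monoʳ-< 2 (s≤s (s≤s z≤n)) e<k) ⟩
  2 ^ k * x                 ≡⟨ 2ᵏx≡1+N ⟩
  suc N                     ∎))
  where open ≤-Reasoning
... | tri> _ _ k<e = ⊥-elim (<-irrefl 2ᵏx≡1+N (s≤s (exponent-minimal N k<e)))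

-- At stage N, the factor 1 / (1 − t q^x) of an odd x has been split as far
-- as the Glaisher step allows while staying in degrees ≤ N:
-- what remains is 1 / (1 − t^(2ᵉ) q^(2ᵉ x)) with e = exponent N x.
oddFactor : ℕ → ℕ → Series → Series
oddFactor N x = if isOdd x then geometric (t^ (2 ^ e)) (2 ^ e * x) else id
  where e = exponent N x

oddProduct : ℕ → ℕ → Series → Series
oddProduct N zero = id
oddProduct N (suc B) = oddFactor N (suc B) ∘ oddProduct N B

distinctProduct : ℕ → Series → Series
distinctProduct zero = id
distinctProduct (suc N) = binomial (t^ twoPow (suc N)) (suc N) ∘ distinctProduct N

oddFactor-linear : ∀ N x → ShiftLinear (oddFactor N x)
oddFactor-linear N x with isOdd x in x-odd
... | false = id-linear
... | true = geometric-linear⁺ (2ᵏm-pos (exponent N x) x-odd)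
  where
  geometric-linear⁺ : ∀ {a M} → 1 ≤ M → ShiftLinear (geometric a M)
  geometric-linear⁺ {a} {suc M} _ = geometric-linear a M

distinctProduct-linear : ∀ N → ShiftLinear (distinctProduct N)
distinctProduct-linear zero = id-linear
distinctProduct-linear (suc N) = ∘-linear (binomial-linear (t^ twoPow (suc N)) (suc N)) (distinctProduct-linear N)

distinctProduct-agree : ∀ N {f g B} → f ≗[ B ] g → distinctProduct N f ≗[ B ] distinctProduct N g
distinctProduct-agree zero f≗g = f≗g
distinctProduct-agree (suc N) f≗g = binomial-agree (t^ twoPow (suc N)) (suc N) (distinctProduct-agree N f≗g)

oddFactor-low : ∀ N x f → oddFactor N x f ≗[ N ] f
oddFactor-low N x f j j≤N with isOdd x in x-odd
... | false = refl
... | true = geometric-below _ _ f (≤-<-trans j≤N (exponent-bound N (odd⇒pos x-odd)))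

oddProduct-low : ∀ N B f → oddProduct N B f ≗[ N ] f
oddProduct-low N zero f j j≤N = refl
oddProduct-low N (suc B) f j j≤N =
  trans (oddFactor-low N (suc B) _ j j≤N) (oddProduct-low N B f j j≤N)

oddFactor-odd : ∀ {N x} → isOdd x ≡ true →
                oddFactor N x ≡ geometric (t^ (2 ^ exponent N x)) (2 ^ exponent N x * x)
oddFactor-odd {N} {x} x-odd with isOdd x | x-odd
... | true | _ = refl

-- Passing from stage N to N + 1 changes only the factor of the odd part m of
-- N + 1 = 2ᵏ m, which splits off 1 + t^(2ᵏ) q^(N+1) by Glaisher's identity.
module Stage {N k m} (m-odd : isOdd m ≡ true) (2ᵏm≡1+N : 2 ^ k * m ≡ suc N) where

  private
    a : Dual
    a = t^ (2 ^ k)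

  exponent-m : exponent N m ≡ k
  exponent-m = exponent-exact (odd⇒pos m-odd) 2ᵏm≡1+N

  exponent-suc-m : exponent (suc N) m ≡ suc k
  exponent-suc-m with 2 ^ exponent N m * m ≟ suc N
  ... | yes _ = cong suc exponent-m
  ... | no 2ᵉm≢1+N = ⊥-elim (2ᵉm≢1+N (trans (cong (λ e → 2 ^ e * m) exponent-m) 2ᵏm≡1+N))

  exponent-other : ∀ {x} → isOdd x ≡ true → x ≢ m → exponent (suc N) x ≡ exponent N x
  exponent-other {x} x-odd x≢m with 2 ^ exponent N x * x ≟ suc N
  ... | no _ = refl
  ... | yes 2ᵉx≡1+N =
    ⊥-elim (x≢m (odd-part-unique (exponent N x) k x-odd m-odd (trans 2ᵉx≡1+N (sym 2ᵏm≡1+N))))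

  oddFactor-other : ∀ {x} → x ≢ m → oddFactor (suc N) x ≡ oddFactor N x
  oddFactor-other {x} x≢m with isOdd x in x-odd
  ... | false = refl
  ... | true = cong (λ e → geometric (t^ (2 ^ e)) (2 ^ e * x)) (exponent-other x-odd x≢m)

  oddFactor-m : oddFactor N m ≡ geometric a (suc N)
  oddFactor-m = begin
    oddFactor N m
      ≡⟨ oddFactor-odd {N} {m} m-odd ⟩
    geometric (t^ (2 ^ exponent N m)) (2 ^ exponent N m * m)
      ≡⟨ cong (λ e → geometric (t^ (2 ^ e)) (2 ^ e * m)) exponent-m ⟩
    geometric a (2 ^ k * m)
      ≡⟨ cong (geometric a) 2ᵏm≡1+N ⟩
    geometric a (suc N)
      ∎
    where open ≡-Reasoning

  oddFactor-suc-m : oddFactor (suc N) m ≡ geometric (a ⋆ a) (suc N + suc N)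
  oddFactor-suc-m = begin
    oddFactor (suc N) m
      ≡⟨ oddFactor-odd {suc N} {m} m-odd ⟩
    geometric (t^ (2 ^ exponent (suc N) m)) (2 ^ exponent (suc N) m * m)
      ≡⟨ cong (λ e → geometric (t^ (2 ^ e)) (2 ^ e * m)) exponent-suc-m ⟩
    geometric (t^ (2 * 2 ^ k)) (2 * 2 ^ k * m)
      ≡⟨ cong₂ geometric (trans (t^-+ (2 ^ k) (2 ^ k)) (cong t^_ (double (2 ^ k))))
                         (trans (double (suc N)) (sym (trans (*-assoc 2 (2 ^ k) m) (cong (2 *_) 2ᵏm≡1+N)))) ⟨
    geometric (a ⋆ a) (suc N + suc N)
      ∎
    where
    open ≡-Reasoning
    double : ∀ y → y + y ≡ 2 * y
    double y = sym (cong (_+_ y) (+-identityʳ y))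

  oddFactor-split : ∀ f → oddFactor N m f ≗ binomial a (suc N) (oddFactor (suc N) m f)
  oddFactor-split f n = begin
    oddFactor N m f n
      ≡⟨ cong (λ o → o f n) oddFactor-m ⟩
    geometric a (suc N) f n
      ≡⟨ geometric-split a N f n ⟩
    binomial a (suc N) (geometric (a ⋆ a) (suc N + suc N) f) n
      ≡⟨ cong (λ o → binomial a (suc N) (o f) n) oddFactor-suc-m ⟨
    binomial a (suc N) (oddFactor (suc N) m f) n
      ∎
    where open ≡-Reasoning

  oddProduct-below : ∀ B → B < m → oddProduct (suc N) B ≡ oddProduct N B
  oddProduct-below zero _ = refl
  oddProduct-below (suc B) 1+B<m =
    cong₂ (λ F G → F ∘ G) (oddFactor-other (<⇒≢ 1+B<m)) (oddProduct-below B (<⇒≤ 1+B<m))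

  oddProduct-split : ∀ B → m ≤ B → ∀ f → oddProduct N B f ≗ binomial a (suc N) (oddProduct (suc N) B f)
  oddProduct-split zero m≤0 with () ← ≤-trans (odd⇒pos m-odd) m≤0
  oddProduct-split (suc B) m≤1+B f n with suc B ≟ m
  ... | yes 1+B≡m = begin
    oddFactor N (suc B) (P B f) n
      ≡⟨ cong (λ x → oddFactor N x (P B f) n) 1+B≡m ⟩
    oddFactor N m (P B f) n
      ≡⟨ cong (λ o → oddFactor N m (o f) n) (oddProduct-below B (≤-reflexive 1+B≡m)) ⟨
    oddFactor N m (P′ B f) n
      ≡⟨ oddFactor-split (P′ B f) n ⟩
    binomial a (suc N) (oddFactor (suc N) m (P′ B f)) n
      ≡⟨ cong (λ x → binomial a (suc N) (oddFactor (suc N) x (P′ B f)) n) 1+B≡m ⟨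
    binomial a (suc N) (oddFactor (suc N) (suc B) (P′ B f)) n
      ∎
    where
    open ≡-Reasoning
    P P′ : ℕ → Series → Series
    P = oddProduct N
    P′ = oddProduct (suc N)
  ... | no 1+B≢m = begin
    oddFactor N (suc B) (P B f) n
      ≡⟨ cong-≗ (oddFactor-linear N (suc B)) (oddProduct-split B m≤B f) n ⟩
    oddFactor N (suc B) (binomial a (suc N) (P′ B f)) n
      ≡⟨ binomial-comm (oddFactor-linear N (suc B)) a (suc N) (P′ B f) n ⟩
    binomial a (suc N) (oddFactor N (suc B) (P′ B f)) n
      ≡⟨ cong (λ o → binomial a (suc N) (o (P′ B f)) n) (oddFactor-other 1+B≢m) ⟨
    binomial a (suc N) (oddFactor (suc N) (suc B) (P′ B f)) n
      ∎
    where
    open ≡-Reasoning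
    P P′ : ℕ → Series → Series
    P = oddProduct N
    P′ = oddProduct (suc N)
    m≤B : m ≤ B
    m≤B = ≤-pred (≤∧≢⇒< m≤1+B (1+B≢m ∘ sym))

glaisher-invariant : ∀ B N → N ≤ B → oddProduct 0 B δ ≗ distinctProduct N (oddProduct N B δ)
glaisher-invariant B zero _ n = refl
glaisher-invariant B (suc N) 1+N≤B n with twoAdic N
... | k , m , m-odd , 2ᵏm≡1+N = begin
  oddProduct 0 B δ n
    ≡⟨ glaisher-invariant B N (<⇒≤ 1+N≤B) n ⟩
  distinctProduct N (oddProduct N B δ) n
    ≡⟨ cong-≗ (distinctProduct-linear N) (oddProduct-split B m≤B δ) n ⟩
  distinctProduct N (binomial (t^ (2 ^ k)) (suc N) (oddProduct (suc N) B δ)) n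
    ≡⟨ binomial-comm (distinctProduct-linear N) (t^ (2 ^ k)) (suc N) _ n ⟩
  binomial (t^ (2 ^ k)) (suc N) (distinctProduct N (oddProduct (suc N) B δ)) n
    ≡⟨ cong (λ e → binomial (t^ e) (suc N) (distinctProduct N (oddProduct (suc N) B δ)) n) 2ᵏ≡twoPow ⟩
  distinctProduct (suc N) (oddProduct (suc N) B δ) n
    ∎
  where
  open ≡-Reasoning
  open Stage {N} {k} {m} m-odd 2ᵏm≡1+N
  m≤B : m ≤ B
  m≤B = ≤-trans (m≤n*m m (2 ^ k) {{m^n≢0 2 k}}) (≤-trans (≤-reflexive 2ᵏm≡1+N) 1+N≤B)
  2ᵏ≡twoPow : 2 ^ k ≡ twoPow (suc N)
  2ᵏ≡twoPow = trans (sym (twoPow-odd-part k m-odd)) (cong twoPow 2ᵏm≡1+N)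

glaisher : ∀ n → oddProduct 0 n δ n ≡ distinctProduct n δ n
glaisher n = trans (glaisher-invariant n n ≤-refl n)
                   (distinctProduct-agree n (oddProduct-low n n δ) n ≤-refl)

-- Sums over partitions

infixr 8 [_]·_

[_]·_ : Bool → Dual → Dual
[ true ]· x = x
[ false ]· x = 0ᴰ

[]·-zero : ∀ b → [ b ]· 0ᴰ ≡ 0ᴰ
[]·-zero true = refl
[]·-zero false = refl

variable
  A B : Set

Σᴰ : (A → Dual) → List A → Dual
Σᴰ g [] = 0ᴰ
Σᴰ g (x ∷ xs) = g x ⊕ Σᴰ g xs

Σᴰ-cong : ∀ {g g′ : A → Dual} → g ≗ g′ → ∀ xs → Σᴰ g xs ≡ Σᴰ g′ xs
Σᴰ-cong g≗g′ [] = refl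
Σᴰ-cong g≗g′ (x ∷ xs) = cong₂ _⊕_ (g≗g′ x) (Σᴰ-cong g≗g′ xs)

Σᴰ-++ : ∀ (g : A → Dual) xs ys → Σᴰ g (xs ++ ys) ≡ Σᴰ g xs ⊕ Σᴰ g ys
Σᴰ-++ g [] ys = refl
Σᴰ-++ g (x ∷ xs) ys = trans (cong (g x ⊕_) (Σᴰ-++ g xs ys)) (sym (⊕-assoc (g x) _ _))

Σᴰ-map : ∀ (g : B → Dual) (h : A → B) xs → Σᴰ g (map h xs) ≡ Σᴰ (g ∘ h) xs
Σᴰ-map g h [] = refl
Σᴰ-map g h (x ∷ xs) = cong (g (h x) ⊕_) (Σᴰ-map g h xs)

Σᴰ-concatMap : ∀ (g : B → Dual) (h : A → List B) xs → Σᴰ g (concatMap h xs) ≡ Σᴰ (Σᴰ g ∘ h) xs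
Σᴰ-concatMap g h [] = refl
Σᴰ-concatMap g h (x ∷ xs) =
  trans (Σᴰ-++ g (h x) (concatMap h xs)) (cong (Σᴰ g (h x) ⊕_) (Σᴰ-concatMap g h xs))

Σᴰ-filter : ∀ (g : A → Dual) {P : A → Set} (P? : Decidable P) xs →
            Σᴰ g (filter P? xs) ≡ Σᴰ (λ x → [ does (P? x) ]· g x) xs
Σᴰ-filter g P? [] = refl
Σᴰ-filter g P? (x ∷ xs) with does (P? x)
... | true  = cong (g x ⊕_) (Σᴰ-filter g P? xs)
... | false = Σᴰ-filter g P? xs

Σᴰ-⋆ : ∀ c (g : A → Dual) xs → Σᴰ (λ x → c ⋆ g x) xs ≡ c ⋆ Σᴰ g xs
Σᴰ-⋆ c g [] = sym (⋆-zeroʳ c)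
Σᴰ-⋆ c g (x ∷ xs) = trans (cong (c ⋆ g x ⊕_) (Σᴰ-⋆ c g xs)) (sym (⋆-distribˡ-⊕ c (g x) _))

Σᴰ-zero : ∀ (xs : List A) → Σᴰ (λ _ → 0ᴰ) xs ≡ 0ᴰ
Σᴰ-zero [] = refl
Σᴰ-zero (x ∷ xs) = Σᴰ-zero xs

Σᴰ-t^ : ∀ (h : A → ℕ) xs → Σᴰ (t^_ ∘ h) xs ≡ (length xs , sum (map h xs))
Σᴰ-t^ h [] = refl
Σᴰ-t^ h (x ∷ xs) = cong (t^ h x ⊕_) (Σᴰ-t^ h xs)

Σᴰ-weight : ∀ (p : A → Bool) (h : A → ℕ) xs →
  Σᴰ (λ x → [ p x ]· t^ h x) xs ≡ (length (filter (T? ∘ p) xs) , sum (map h (filter (T? ∘ p) xs)))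
Σᴰ-weight p h xs = trans (sym (Σᴰ-filter (t^_ ∘ h) (T? ∘ p) xs)) (Σᴰ-t^ h (filter (T? ∘ p) xs))

Σ< : ℕ → (ℕ → Dual) → Dual
Σ< zero h = 0ᴰ
Σ< (suc L) h = h 0 ⊕ Σ< L (h ∘ suc)

Σᴰ-applyUpTo : ∀ (h : ℕ → Dual) f L → Σᴰ h (applyUpTo f L) ≡ Σ< L (h ∘ f)
Σᴰ-applyUpTo h f zero = refl
Σᴰ-applyUpTo h f (suc L) = cong (h (f 0) ⊕_) (Σᴰ-applyUpTo h (f ∘ suc) L)

Σ<-cong : ∀ L {h h′} → h ≗ h′ → Σ< L h ≡ Σ< L h′
Σ<-cong zero h≗h′ = refl
Σ<-cong (suc L) h≗h′ = cong₂ _⊕_ (h≗h′ 0) (Σ<-cong L (h≗h′ ∘ suc))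

Σ<-zero : ∀ L → Σ< L (λ _ → 0ᴰ) ≡ 0ᴰ
Σ<-zero zero = refl
Σ<-zero (suc L) = Σ<-zero L

Σ<-bound-suc : ∀ L m (H : ℕ → Dual) →
  Σ< L (λ k → [ suc k ≤ᵇ suc m ]· H k) ≡ Σ< L (λ k → [ suc k ≤ᵇ m ]· H k) ⊕ [ m <ᵇ L ]· H m
Σ<-bound-suc zero m H = refl
Σ<-bound-suc (suc L) zero H = begin
  H 0 ⊕ Σ< L (λ _ → 0ᴰ)           ≡⟨ cong (H 0 ⊕_) (Σ<-zero L) ⟩
  H 0 ⊕ 0ᴰ                         ≡⟨ ⊕-comm (H 0) 0ᴰ ⟩
  0ᴰ ⊕ H 0                         ≡⟨ cong (λ z → (0ᴰ ⊕ z) ⊕ H 0) (Σ<-zero L) ⟨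
  (0ᴰ ⊕ Σ< L (λ _ → 0ᴰ)) ⊕ H 0     ∎
  where open ≡-Reasoning
Σ<-bound-suc (suc L) (suc m) H = begin
  H 0 ⊕ Σ< L (λ k → [ suc k ≤ᵇ suc m ]· H (suc k))
    ≡⟨ cong (H 0 ⊕_) (Σ<-bound-suc L m (H ∘ suc)) ⟩
  H 0 ⊕ (Σ< L (λ k → [ suc k ≤ᵇ m ]· H (suc k)) ⊕ [ m <ᵇ L ]· H (suc m))
    ≡⟨ ⊕-assoc (H 0) _ _ ⟨
  (H 0 ⊕ Σ< L (λ k → [ suc k ≤ᵇ m ]· H (suc k))) ⊕ [ m <ᵇ L ]· H (suc m)
    ∎
  where open ≡-Reasoning

partsAux-fuel : ∀ {fuel fuel′ n} m → n ≤ fuel → n ≤ fuel′ → partsAux fuel n m ≡ partsAux fuel′ n m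
partsAux-fuel {n = zero} m _ _ = refl
partsAux-fuel {suc fuel} {suc fuel′} {suc n} m (s≤s n≤fuel) (s≤s n≤fuel′) =
  concatMap-cong (λ k → cong (map (suc k ∷_)) (partsAux-fuel (suc k)
    (≤-trans (m∸n≤m n k) n≤fuel) (≤-trans (m∸n≤m n k) n≤fuel′)))
  (filter (λ k → suc k ≤? m) (upTo (suc n)))

Σᴰ-partsAux : ∀ (g : List ℕ → Dual) fuel n m → Σᴰ g (partsAux (suc fuel) (suc n) m) ≡
              Σ< (suc n) (λ k → [ suc k ≤ᵇ m ]· Σᴰ (g ∘ (suc k ∷_)) (partsAux fuel (n ∸ k) (suc k)))
Σᴰ-partsAux g fuel n m = begin
  Σᴰ g (concatMap (λ k → map (suc k ∷_) (P k)) (filter (λ k → suc k ≤? m) (upTo (suc n))))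
    ≡⟨ Σᴰ-concatMap g _ _ ⟩
  Σᴰ (λ k → Σᴰ g (map (suc k ∷_) (P k))) (filter (λ k → suc k ≤? m) (upTo (suc n)))
    ≡⟨ Σᴰ-filter _ (λ k → suc k ≤? m) (upTo (suc n)) ⟩
  Σᴰ (λ k → [ suc k ≤ᵇ m ]· Σᴰ g (map (suc k ∷_) (P k))) (upTo (suc n))
    ≡⟨ Σᴰ-applyUpTo _ id (suc n) ⟩
  Σ< (suc n) (λ k → [ suc k ≤ᵇ m ]· Σᴰ g (map (suc k ∷_) (P k)))
    ≡⟨ Σ<-cong (suc n) (λ k → cong ([ suc k ≤ᵇ m ]·_) (Σᴰ-map g (suc k ∷_) (P k))) ⟩
  Σ< (suc n) (λ k → [ suc k ≤ᵇ m ]· Σᴰ (g ∘ (suc k ∷_)) (P k))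
    ∎
  where
  open ≡-Reasoning
  P : ℕ → List (List ℕ)
  P k = partsAux fuel (n ∸ k) (suc k)

partitionSum : (List ℕ → Dual) → ℕ → ℕ → Dual
partitionSum g n m = Σᴰ g (partsAux n n m)

partitionSum-bound-suc : ∀ g n m → partitionSum g (suc n) (suc m) ≡
  partitionSum g (suc n) m ⊕ [ m <ᵇ suc n ]· Σᴰ (g ∘ (suc m ∷_)) (partsAux n (n ∸ m) (suc m))
partitionSum-bound-suc g n m = begin
  partitionSum g (suc n) (suc m)                   ≡⟨ Σᴰ-partsAux g n n (suc m) ⟩
  Σ< (suc n) (λ k → [ suc k ≤ᵇ suc m ]· H k)        ≡⟨ Σ<-bound-suc (suc n) m H ⟩
  Σ< (suc n) (λ k → [ suc k ≤ᵇ m ]· H k) ⊕ [ m <ᵇ suc n ]· H m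
    ≡⟨ cong (_⊕ [ m <ᵇ suc n ]· H m) (Σᴰ-partsAux g n n m) ⟨
  partitionSum g (suc n) m ⊕ [ m <ᵇ suc n ]· H m    ∎
  where
  open ≡-Reasoning
  H : ℕ → Dual
  H k = Σᴰ (g ∘ (suc k ∷_)) (partsAux n (n ∸ k) (suc k))

-- Splitting off the partitions whose largest part is m + 1.
partitionSum-recurrence : ∀ g a g′ m → (∀ μ → g (suc m ∷ μ) ≡ a ⋆ g′ μ) → ∀ n →
  partitionSum g n (suc m) ≡ partitionSum g n m ⊕ a ⋆ shift (suc m) (λ N → partitionSum g′ N (suc m)) n
partitionSum-recurrence g a g′ m g-∷ zero =
  sym (trans (cong (g [] ⊕ 0ᴰ ⊕_) (⋆-zeroʳ a)) (⊕-identityʳ _))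
partitionSum-recurrence g a g′ m g-∷ (suc n) =
  trans (partitionSum-bound-suc g n m) (cong (partitionSum g (suc n) m ⊕_) (largest (m <? suc n)))
  where
  open ≡-Reasoning
  F : Series
  F N = partitionSum g′ N (suc m)
  largest : (m<1+n? : Dec (m < suc n)) →
            [ does m<1+n? ]· Σᴰ (g ∘ (suc m ∷_)) (partsAux n (n ∸ m) (suc m)) ≡
            a ⋆ shift (suc m) F (suc n)
  largest (yes m<1+n) = begin
    Σᴰ (g ∘ (suc m ∷_)) (partsAux n (n ∸ m) (suc m))
      ≡⟨ Σᴰ-cong g-∷ _ ⟩
    Σᴰ (λ μ → a ⋆ g′ μ) (partsAux n (n ∸ m) (suc m))
      ≡⟨ Σᴰ-⋆ a g′ _ ⟩
    a ⋆ Σᴰ g′ (partsAux n (n ∸ m) (suc m))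
      ≡⟨ cong (λ μs → a ⋆ Σᴰ g′ μs) (partsAux-fuel (suc m) (m∸n≤m n m) ≤-refl) ⟩
    a ⋆ F (n ∸ m)
      ≡⟨ cong (a ⋆_) (shift-above (suc m) F m<1+n) ⟨
    a ⋆ shift (suc m) F (suc n)
      ∎
  largest (no m≮1+n) = begin
    0ᴰ                           ≡⟨ ⋆-zeroʳ a ⟨
    a ⋆ 0ᴰ                       ≡⟨ cong (a ⋆_) (shift-below (suc m) F (s≤s (≮⇒≥ m≮1+n))) ⟨
    a ⋆ shift (suc m) F (suc n)  ∎

partitionSum-bound-zero : ∀ {g} → g [] ≡ t^ 0 → (λ n → partitionSum g n 0) ≗ δ
partitionSum-bound-zero {g} g[]≡1 zero = trans (⊕-identityʳ (g [])) g[]≡1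
partitionSum-bound-zero {g} g[]≡1 (suc n) = trans (Σᴰ-partsAux g n n 0) (Σ<-zero (suc n))

-- The two generating functions

oddWeight : List ℕ → Dual
oddWeight μ = [ allOddParts μ ]· t^ length μ

oddWeight-∷ : ∀ x μ → oddWeight (x ∷ μ) ≡ ([ isOdd x ]· t^ 1) ⋆ oddWeight μ
oddWeight-∷ x μ with isOdd x | allOddParts μ
... | true  | true  = sym (t^-+ 1 (length μ))
... | true  | false = sym (⋆-zeroʳ (t^ 1))
... | false | _     = sym (⋆-zeroˡ (oddWeight μ))

oddSeries : ℕ → Series
oddSeries m n = partitionSum oddWeight n m

oddSeries≗oddProduct : ∀ m → oddSeries m ≗ oddProduct 0 m δ
oddSeries≗oddProduct zero = partitionSum-bound-zero refl
oddSeries≗oddProduct (suc m) n with isOdd (suc m) in 1+m-odd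
... | true = begin
  oddSeries (suc m) n
    ≡⟨ geometric-unique (t^ 1) m (oddSeries m)
         (partitionSum-recurrence oddWeight (t^ 1) oddWeight m weight-∷) n ⟩
  geometric (t^ 1) (suc m) (oddSeries m) n
    ≡⟨ cong-≗ (geometric-linear (t^ 1) m) (oddSeries≗oddProduct m) n ⟩
  geometric (t^ 1) (suc m) (oddProduct 0 m δ) n
    ≡⟨ cong (λ M → geometric (t^ 1) M (oddProduct 0 m δ) n) (*-identityˡ (suc m)) ⟨
  geometric (t^ 1) (1 * suc m) (oddProduct 0 m δ) n
    ∎
  where
  open ≡-Reasoning
  weight-∷ : ∀ μ → oddWeight (suc m ∷ μ) ≡ t^ 1 ⋆ oddWeight μ
  weight-∷ μ = trans (oddWeight-∷ (suc m) μ) (cong (λ b → ([ b ]· t^ 1) ⋆ oddWeight μ) 1+m-odd)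
... | false = begin
  oddSeries (suc m) n
    ≡⟨ partitionSum-recurrence oddWeight 0ᴰ oddWeight m weight-∷ n ⟩
  oddSeries m n ⊕ 0ᴰ ⋆ shift (suc m) (oddSeries (suc m)) n
    ≡⟨ cong (oddSeries m n ⊕_) (⋆-zeroˡ (shift (suc m) (oddSeries (suc m)) n)) ⟩
  oddSeries m n ⊕ 0ᴰ
    ≡⟨ ⊕-identityʳ _ ⟩
  oddSeries m n
    ≡⟨ oddSeries≗oddProduct m n ⟩
  oddProduct 0 m δ n
    ∎
  where
  open ≡-Reasoning
  weight-∷ : ∀ μ → oddWeight (suc m ∷ μ) ≡ 0ᴰ ⋆ oddWeight μ
  weight-∷ μ = trans (oddWeight-∷ (suc m) μ) (cong (λ b → ([ b ]· t^ 1) ⋆ oddWeight μ) 1+m-odd)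

distinctWeight : List ℕ → Dual
distinctWeight μ = [ distinctParts μ ]· t^ sum (map twoPow μ)

headBelow : ℕ → List ℕ → Bool
headBelow x [] = true
headBelow x (y ∷ μ) = y <ᵇ x

distinctWeight-∷ : ∀ x μ → distinctWeight (x ∷ μ) ≡ t^ twoPow x ⋆ [ headBelow x μ ]· distinctWeight μ
distinctWeight-∷ x [] = sym (t^-+ (twoPow x) 0)
distinctWeight-∷ x (y ∷ μ) with y <ᵇ x | distinctParts (y ∷ μ)
... | true  | true  = sym (t^-+ (twoPow x) (sum (map twoPow (y ∷ μ))))
... | true  | false = sym (⋆-zeroʳ (t^ twoPow x))
... | false | _     = sym (⋆-zeroʳ (t^ twoPow x))

<ᵇ-suc : ∀ k m → (k <ᵇ m) ≡ true → (k <ᵇ suc m) ≡ true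
<ᵇ-suc zero m _ = refl
<ᵇ-suc (suc k) (suc m) k<ᵇm = <ᵇ-suc k m k<ᵇm

Σᴰ-headBelow : ∀ fuel N m → N ≤ fuel →
  Σᴰ (λ μ → [ headBelow (suc m) μ ]· distinctWeight μ) (partsAux fuel N (suc m)) ≡
  Σᴰ distinctWeight (partsAux fuel N m)
Σᴰ-headBelow fuel zero m _ = refl
Σᴰ-headBelow (suc fuel) (suc N) m (s≤s N≤fuel) = begin
  Σᴰ below (partsAux (suc fuel) (suc N) (suc m))
    ≡⟨ Σᴰ-partsAux below fuel N (suc m) ⟩
  Σ< (suc N) (λ k → [ suc k ≤ᵇ suc m ]· Σᴰ (below ∘ (suc k ∷_)) (P k))
    ≡⟨ Σ<-cong (suc N) first-part ⟩
  Σ< (suc N) (λ k → [ suc k ≤ᵇ m ]· Σᴰ (distinctWeight ∘ (suc k ∷_)) (P k))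
    ≡⟨ Σᴰ-partsAux distinctWeight fuel N m ⟨
  Σᴰ distinctWeight (partsAux (suc fuel) (suc N) m)
    ∎
  where
  open ≡-Reasoning
  below : List ℕ → Dual
  below μ = [ headBelow (suc m) μ ]· distinctWeight μ
  P : ℕ → List (List ℕ)
  P k = partsAux fuel (N ∸ k) (suc k)
  first-part : ∀ k → [ suc k ≤ᵇ suc m ]· Σᴰ (below ∘ (suc k ∷_)) (P k) ≡
                     [ suc k ≤ᵇ m ]· Σᴰ (distinctWeight ∘ (suc k ∷_)) (P k)
  first-part k with k <ᵇ m in k<ᵇm
  ... | true rewrite <ᵇ-suc k m k<ᵇm = refl
  ... | false = trans (cong ([ k <ᵇ suc m ]·_) (Σᴰ-zero (P k))) ([]·-zero (k <ᵇ suc m))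

distinctSeries : ℕ → Series
distinctSeries m n = partitionSum distinctWeight n m

distinctSeries≗distinctProduct : ∀ m → distinctSeries m ≗ distinctProduct m δ
distinctSeries≗distinctProduct zero = partitionSum-bound-zero refl
distinctSeries≗distinctProduct (suc m) n = begin
  distinctSeries (suc m) n
    ≡⟨ partitionSum-recurrence distinctWeight a below m (distinctWeight-∷ (suc m)) n ⟩
  distinctSeries m n ⊕ a ⋆ shift (suc m) (λ N → partitionSum below N (suc m)) n
    ≡⟨ cong (λ z → distinctSeries m n ⊕ a ⋆ z)
            (shift-cong (suc m) (λ N → Σᴰ-headBelow N N m ≤-refl) n) ⟩
  binomial a (suc m) (distinctSeries m) n
    ≡⟨ cong-≗ (binomial-linear a (suc m)) (distinctSeries≗distinctProduct m) n ⟩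
  binomial a (suc m) (distinctProduct m δ) n
    ∎
  where
  open ≡-Reasoning
  a : Dual
  a = t^ twoPow (suc m)
  below : List ℕ → Dual
  below μ = [ headBelow (suc m) μ ]· distinctWeight μ

oddSeries≡distinctSeries : ∀ n → oddSeries n n ≡ distinctSeries n n
oddSeries≡distinctSeries n = begin
  oddSeries n n           ≡⟨ oddSeries≗oddProduct n n ⟩
  oddProduct 0 n δ n      ≡⟨ glaisher n ⟩
  distinctProduct n δ n   ≡⟨ distinctSeries≗distinctProduct n n ⟨
  distinctSeries n n      ∎
  where open ≡-Reasoning

sum-twoPow : ∀ μ → sum (map twoPow μ) ≡ length μ + wt μ
sum-twoPow [] = refl
sum-twoPow (x ∷ μ) = begin
  twoPow x + sum (map twoPow μ)
    ≡⟨ cong₂ _+_ (sym (m∸n+n≡m (twoPow-pos x))) (sum-twoPow μ) ⟩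
  (twoPow x ∸ 1) + 1 + (length μ + wt μ)
    ≡⟨ lemma (twoPow x ∸ 1) (length μ) (wt μ) ⟩
  suc (length μ) + (twoPow x ∸ 1 + wt μ)
    ∎
  where
  open ≡-Reasoning
  lemma : ∀ t l w → t + 1 + (l + w) ≡ suc l + (t + w)
  lemma = solve-∀

sum-sum-twoPow : ∀ μs → sum (map (sum ∘ map twoPow) μs) ≡ totalParts μs + sum (map wt μs)
sum-sum-twoPow [] = refl
sum-sum-twoPow (μ ∷ μs) = trans (cong₂ _+_ (sum-twoPow μ) (sum-sum-twoPow μs))
  (+-interchange (length μ) (wt μ) (totalParts μs) (sum (map wt μs)))

length-replicateL : ∀ k (x : A) → length (replicateL k x) ≡ k
length-replicateL zero x = refl
length-replicateL (suc k) x = cong suc (length-replicateL k x)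

length-concatMap-replicateL : ∀ (f : A → ℕ) xs →
                              length (concatMap (λ x → replicateL (f x) x) xs) ≡ sum (map f xs)
length-concatMap-replicateL f [] = refl
length-concatMap-replicateL f (x ∷ xs) =
  trans (length-++ (replicateL (f x) x)) (cong₂ _+_ (length-replicateL (f x) x) (length-concatMap-replicateL f xs))

totalParts-odd : ∀ n → totalParts (oddPartitions n) ≡
                       totalParts (distinctPartitions n) + sum (map wt (distinctPartitions n))
totalParts-odd n = begin
  totalParts (oddPartitions n)
    ≡⟨ cong proj₂ (Σᴰ-weight allOddParts length (partitions n)) ⟨
  proj₂ (oddSeries n n)
    ≡⟨ cong proj₂ (oddSeries≡distinctSeries n) ⟩
  proj₂ (distinctSeries n n)
    ≡⟨ cong proj₂ (Σᴰ-weight distinctParts (sum ∘ map twoPow) (partitions n)) ⟩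
  sum (map (sum ∘ map twoPow) (distinctPartitions n))
    ≡⟨ sum-sum-twoPow (distinctPartitions n) ⟩
  totalParts (distinctPartitions n) + sum (map wt (distinctPartitions n))
    ∎
  where open ≡-Reasoning

+[m+n]-+m≡+n : ∀ m n → + (m + n) ℤ.- + m ≡ + n
+[m+n]-+m≡+n m n =
  trans (ℤ.[+m]-[+n]≡m⊖n (m + n) m) (trans (ℤ.⊖-≥ (m≤m+n m n)) (cong +_ (m+n∸m≡n m n)))

mainTheorem3 : (n : ℕ) → n ≥ 1 →
    (b n ≡ + length (MD n)) × (length (MD n) ≡ sum (map wt (distinctPartitions n)))
mainTheorem3 n _ = b≡+length-MD , length-MD
  where
  D W : ℕ
  D = totalParts (distinctPartitions n)
  W = sum (map wt (distinctPartitions n))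
  length-MD : length (MD n) ≡ W
  length-MD = length-concatMap-replicateL wt (distinctPartitions n)
  b≡+length-MD : b n ≡ + length (MD n)
  b≡+length-MD = begin
    + totalParts (oddPartitions n) ℤ.- + D   ≡⟨ cong (λ t → + t ℤ.- + D) (totalParts-odd n) ⟩
    + (D + W) ℤ.- + D                        ≡⟨ +[m+n]-+m≡+n D W ⟩
    + W                                      ≡⟨ cong +_ length-MD ⟨
    + length (MD n)                          ∎
    where open ≡-Reasoning
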